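{- Let $\mathcal{G}'$ be the set of partitions $\lambda=(\lambda_1\ge\lambda_2\ge\cdots\ge\lambda_\ell)$ into positive parts (empty partition included) such that $\lambda_{2i-1}-\lambda_{2i}\ge3$ whenever $2i\le\ell$, $\lambda_{2i}-\lambda_{2i+1}$ is even whenever $2i+1\le\ell$, and the smallest part $\lambda_\ell$ is at least $3$ if $\ell$ is odd and is even if $\ell$ is even. For a partition let $|\lambda_o|=\lambda_1+\lambda_3+\cdots$ and $|\lambda_e|=\lambda_2+\lambda_4+\cdots$. Then $$\sum_{\lambda\in\mathcal{G}'}x^{|\lambda_{o}|}y^{|\lambda_{e}|}=\sum_{n=0}^{\infty}\frac{x^{\frac{3n^2+3n}{2}}y^{\frac{3n^2-3n}{2}}}{(x;xy)_n(x^2y^2;x^2y^2)_{n}}.$$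
   Context: $(a;t)_n=\prod_{i=0}^{n-1}(1-at^i)$; identity of formal power series in $x,y$. -}

module Defs where

open import Data.Nat as ℕ using (ℕ; zero; suc; _≥_; _∸_; _≡ᵇ_)
open import Data.Nat.Divisibility using (_∣_)
open import Data.Nat.DivMod using (_/_)
open import Data.Integer as ℤ using (ℤ; 0ℤ; 1ℤ)
open import Data.Bool using (if_then_else_; _∧_)
open import Data.List using (List; []; _∷_)
open import Data.List.Relation.Unary.All using (All)
open import Data.List.Relation.Unary.Linked using (Linked)
open import Data.Unit using (⊤)
open import Data.Product using (_×_)
open import Relation.Binary.PropositionalEquality using (_≡_)

IsPartition : List ℕ → Set
IsPartition ps = All (λ p → p ≥ 1) ps × Linked _≥_ ps

GCond : List ℕ → Set
GCond []                = ⊤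
GCond (a ∷ [])          = a ≥ 3
GCond (a ∷ b ∷ [])      = (a ≥ 3 ℕ.+ b) × (2 ∣ b)
GCond (a ∷ b ∷ c ∷ ps)  = (a ≥ 3 ℕ.+ b) × (2 ∣ (b ∸ c)) × GCond (c ∷ ps)

InG' : List ℕ → Set
InG' ps = IsPartition ps × GCond ps

oddSum evenSum : List ℕ → ℕ
oddSum []       = 0
oddSum (a ∷ ps) = a ℕ.+ evenSum ps
evenSum []       = 0
evenSum (a ∷ ps) = oddSum ps

-- Formal power series in x, y with integer coefficients:
-- f i j = coefficient of x^i y^j.

Series : Set
Series = ℕ → ℕ → ℤ

sumUpTo : ℕ → (ℕ → ℤ) → ℤ
sumUpTo zero    f = f 0
sumUpTo (suc n) f = sumUpTo n f ℤ.+ f (suc n)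

_≈S_ : Series → Series → Set
f ≈S g = ∀ i j → f i j ≡ g i j

mono : ℕ → ℕ → Series
mono a b i j = if (i ≡ᵇ a) ∧ (j ≡ᵇ b) then 1ℤ else 0ℤ

oneS : Series
oneS = mono 0 0

_-S_ : Series → Series → Series
(f -S g) i j = f i j ℤ.- g i j

_*S_ : Series → Series → Series
(f *S g) i j = sumUpTo i (λ k → sumUpTo j (λ l → f k l ℤ.* g (i ∸ k) (j ∸ l)))

_^S_ : Series → ℕ → Series
t ^S zero  = oneS
t ^S suc n = (t ^S n) *S t

poch : Series → Series → ℕ → Series
poch a t zero    = oneS
poch a t (suc n) = poch a t n *S (oneS -S (a *S (t ^S n)))

denom : ℕ → Series
denom n = poch (mono 1 0) (mono 1 1) n *S poch (mono 2 2) (mono 2 2) n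

ex ey : ℕ → ℕ
ex n = 3 ℕ.* ((n ℕ.* suc n) / 2)
ey n = 3 ℕ.* ((n ℕ.* (n ∸ 1)) / 2)

-- Coefficient of x^a y^b in  Σ_n x^{ex n} y^{ey n} · P n , where P n is
-- the inverse of denom n.  Terms with n > a have x-degree ≥ ex n > a and
-- contribute nothing, so the (formally infinite) sum is truncated at n = a.
rhsCoeff : (ℕ → Series) → ℕ → ℕ → ℤ
rhsCoeff P a b = sumUpTo a (λ n → (mono (ex n) (ey n) *S P n) a b)

-- A partition in 𝒢' with 2n or 2n − 1 parts is cut into the n pairs (λ₁, λ₂), …, (λ_{2n−1}, λ_{2n}),
-- with λ_{2n} = 0 when the length is odd. Such pair lists are built from n pairs (d_k, e_k) of
-- natural numbers: at step k every pair built so far is raised by c_k = 3 + d_k + 2e_k in both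
-- entries and the pair (c_k, 2e_k) is appended; the conditions defining 𝒢' say precisely that every
-- partition arises in exactly one way. Step k contributes x^{3k} y^{3k−3} (x^k y^{k−1})^{d_k}
-- (x^{2k} y^{2k})^{e_k}, so the partitions with n pairs are counted by x^{(3n²+3n)/2} y^{(3n²−3n)/2}
-- times the product of the geometric series of x^k y^{k−1} and x^{2k} y^{2k}, k = 1, …, n. In the
-- ring ℤ⟦y⟧⟦x⟧ that product is an inverse of (x;xy)_n (x²y²;x²y²)_n, hence equal to the given one.
module Submission where

open import Defs
open import Data.Nat using (ℕ)
open import Data.Integer using (+_)
open import Data.List using (List; length)
open import Data.List.Membership.Propositional using (_∈_)
open import Data.List.Relation.Unary.Unique.Propositional using (Unique)
open import Data.Product using (Σ; _×_)
open import Function using (_⇔_)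
open import Relation.Binary.PropositionalEquality using (_≡_)

open import Algebra.Bundles using (CommutativeRing; CommutativeMonoid)
open import Data.Bool using (Bool; true; false; if_then_else_; _∧_; T)
open import Data.Bool.Properties using (T-∧)
open import Data.Empty using (⊥-elim)
open import Data.Integer as ℤ using (ℤ; 0ℤ; 1ℤ)
import Data.Integer.Properties as ℤ
open import Data.List using ([]; _∷_; _++_; _∷ʳ_; map; cartesianProduct; initLast; _∷ʳ′_)
open import Data.List.Properties using (length-++; length-map; map-++; ∷ʳ-injective; map-injective)
open import Data.List.Membership.Propositional.Properties
  using (∈-++⁺ˡ; ∈-++⁺ʳ; ∈-++⁻; ∈-map⁺; ∈-map⁻; ∈-cartesianProduct⁺; ∈-cartesianProduct⁻)
open import Data.List.Relation.Unary.All using (All; []; _∷_)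
import Data.List.Relation.Unary.All as All
open import Data.List.Relation.Unary.AllPairs using ([]; _∷_)
open import Data.List.Relation.Unary.Any using (here)
open import Data.List.Relation.Unary.Linked using (Linked; []; [-]; _∷_)
import Data.List.Relation.Unary.Unique.Propositional.Properties as Unique
open import Data.Nat as ℕ using (zero; suc; _∸_; _≤_; _<_; _≥_; z≤n; s≤s; _≡ᵇ_; NonZero)
import Data.Nat.Properties as ℕ
open import Data.Nat.Divisibility using (_∣_; divides)
open import Data.Nat.DivMod using (_/_; m*n/n≡m; +-distrib-/-∣ʳ)
open import Data.Nat.ListAction using (sum)
open import Data.Nat.ListAction.Properties using (sum-++)
open import Data.Nat.Tactic.RingSolver using (solve-∀)
open import Data.Product using (_,_; proj₁; proj₂)
open import Data.Sum using (inj₁; inj₂)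
open import Data.Unit using (⊤; tt)
open import Function using (Equivalence; mk⇔; _∘_)
open import Relation.Nullary using (Dec; yes; no; ¬_)
open import Relation.Nullary.Decidable using (_×-dec_; map′)
open import Relation.Binary.PropositionalEquality using (refl; cong; cong₂; subst; subst₂)
import Relation.Binary.PropositionalEquality as ≡

module _ {c ℓ} (M : CommutativeMonoid c ℓ) where

  open CommutativeMonoid M
  open import Relation.Binary.Reasoning.Setoid setoid

  inverse-unique : ∀ {x y z} → x ∙ z ≈ ε → y ∙ z ≈ ε → x ≈ y
  inverse-unique {x} {y} {z} xz≈ε yz≈ε = begin
    x            ≈⟨ identityʳ x ⟨
    x ∙ ε        ≈⟨ ∙-congˡ yz≈ε ⟨
    x ∙ (y ∙ z)  ≈⟨ ∙-congˡ (comm y z) ⟩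
    x ∙ (z ∙ y)  ≈⟨ assoc x z y ⟨
    (x ∙ z) ∙ y  ≈⟨ ∙-congʳ xz≈ε ⟩
    ε ∙ y        ≈⟨ identityˡ y ⟩
    y            ∎

-- Formal power series over a commutative ring

module FormalPowerSeries {c ℓ} (R : CommutativeRing c ℓ) where

  open CommutativeRing R hiding (zero) renaming (refl to ≈-refl)
  open import Relation.Binary.Reasoning.Setoid setoid

  ∑≤ : ℕ → (ℕ → Carrier) → Carrier
  ∑≤ zero    f = f 0
  ∑≤ (suc n) f = ∑≤ n f + f (suc n)

  ∑≤-congᵇ : ∀ n {f g : ℕ → Carrier} → (∀ k → k ≤ n → f k ≈ g k) → ∑≤ n f ≈ ∑≤ n g
  ∑≤-congᵇ zero    f≈g = f≈g 0 z≤n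
  ∑≤-congᵇ (suc n) f≈g =
    +-cong (∑≤-congᵇ n (λ k k≤n → f≈g k (ℕ.m≤n⇒m≤1+n k≤n))) (f≈g (suc n) ℕ.≤-refl)

  ∑≤-cong : ∀ n {f g : ℕ → Carrier} → (∀ k → f k ≈ g k) → ∑≤ n f ≈ ∑≤ n g
  ∑≤-cong n f≈g = ∑≤-congᵇ n (λ k _ → f≈g k)

  ∑≤-suc : ∀ n (f : ℕ → Carrier) → ∑≤ (suc n) f ≈ f 0 + ∑≤ n (λ k → f (suc k))
  ∑≤-suc zero    f = ≈-refl
  ∑≤-suc (suc n) f = trans (+-congʳ (∑≤-suc n f)) (+-assoc _ _ _)

  ∑≤-+ : ∀ n (f g : ℕ → Carrier) → ∑≤ n (λ k → f k + g k) ≈ ∑≤ n f + ∑≤ n g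
  ∑≤-+ zero    f g = ≈-refl
  ∑≤-+ (suc n) f g = trans (+-congʳ (∑≤-+ n f g)) (interchange _ _ _ _)
    where open import Algebra.Properties.CommutativeSemigroup +-commutativeSemigroup using (interchange)

  *-distribˡ-∑≤ : ∀ n x (f : ℕ → Carrier) → x * ∑≤ n f ≈ ∑≤ n (λ k → x * f k)
  *-distribˡ-∑≤ zero    x f = ≈-refl
  *-distribˡ-∑≤ (suc n) x f = trans (distribˡ _ _ _) (+-congʳ (*-distribˡ-∑≤ n x f))

  *-distribʳ-∑≤ : ∀ n x (f : ℕ → Carrier) → ∑≤ n f * x ≈ ∑≤ n (λ k → f k * x)
  *-distribʳ-∑≤ zero    x f = ≈-refl
  *-distribʳ-∑≤ (suc n) x f = trans (distribʳ _ _ _) (+-congʳ (*-distribʳ-∑≤ n x f))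

  ∑≤-0# : ∀ n → ∑≤ n (λ _ → 0#) ≈ 0#
  ∑≤-0# zero    = ≈-refl
  ∑≤-0# (suc n) = trans (+-identityʳ _) (∑≤-0# n)

  antidiagonal : ℕ → (ℕ → ℕ → Carrier) → Carrier
  antidiagonal i F = ∑≤ i (λ k → F k (i ∸ k))

  antidiagonal-cong : ∀ i {F G : ℕ → ℕ → Carrier} →
                      (∀ a b → F a b ≈ G a b) → antidiagonal i F ≈ antidiagonal i G
  antidiagonal-cong i F≈G = ∑≤-cong i (λ k → F≈G k (i ∸ k))

  antidiagonal-sucˡ : ∀ i F → antidiagonal (suc i) F ≈ F 0 (suc i) + antidiagonal i (λ a b → F (suc a) b)
  antidiagonal-sucˡ i F = ∑≤-suc i (λ k → F k (suc i ∸ k))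

  antidiagonal-sucʳ : ∀ i F → antidiagonal (suc i) F ≈ antidiagonal i (λ a b → F a (suc b)) + F (suc i) 0
  antidiagonal-sucʳ i F =
    +-cong (∑≤-congᵇ i (λ k k≤i → reflexive (≡.cong (F k) (ℕ.+-∸-assoc 1 k≤i))))
           (reflexive (≡.cong (F (suc i)) (ℕ.n∸n≡0 i)))

  antidiagonal-swap : ∀ i F → antidiagonal i F ≈ antidiagonal i (λ a b → F b a)
  antidiagonal-swap zero    F = ≈-refl
  antidiagonal-swap (suc i) F = begin
    antidiagonal (suc i) F                                      ≈⟨ antidiagonal-sucˡ i F ⟩
    F 0 (suc i) + antidiagonal i (λ a b → F (suc a) b)          ≈⟨ +-congˡ (antidiagonal-swap i (λ a b → F (suc a) b)) ⟩
    F 0 (suc i) + antidiagonal i (λ a b → F (suc b) a)          ≈⟨ +-comm _ _ ⟩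
    antidiagonal i (λ a b → F (suc b) a) + F 0 (suc i)          ≈⟨ antidiagonal-sucʳ i (λ a b → F b a) ⟨
    antidiagonal (suc i) (λ a b → F b a)                        ∎

  antidiagonal-+ : ∀ i F G → antidiagonal i (λ a b → F a b + G a b) ≈ antidiagonal i F + antidiagonal i G
  antidiagonal-+ i F G = ∑≤-+ i (λ k → F k (i ∸ k)) (λ k → G k (i ∸ k))

  antidiagonal-assoc : ∀ i (F : ℕ → ℕ → ℕ → Carrier) →
    antidiagonal i (λ k c → antidiagonal k (λ a b → F a b c)) ≈
    antidiagonal i (λ a r → antidiagonal r (λ b c → F a b c))
  antidiagonal-assoc zero    F = ≈-refl
  antidiagonal-assoc (suc i) F = begin
    antidiagonal (suc i) (λ k c → antidiagonal k (λ a b → F a b c))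
      ≈⟨ antidiagonal-sucˡ i (λ k c → antidiagonal k (λ a b → F a b c)) ⟩
    F 0 0 (suc i) + antidiagonal i (λ k c → antidiagonal (suc k) (λ a b → F a b c))
      ≈⟨ +-congˡ (antidiagonal-cong i (λ k c → antidiagonal-sucˡ k (λ a b → F a b c))) ⟩
    F 0 0 (suc i) + antidiagonal i (λ k c → F 0 (suc k) c + antidiagonal k (λ a b → F (suc a) b c))
      ≈⟨ +-congˡ (antidiagonal-+ i (λ k c → F 0 (suc k) c) (λ k c → antidiagonal k (λ a b → F (suc a) b c))) ⟩
    F 0 0 (suc i) + (antidiagonal i (λ k c → F 0 (suc k) c)
                     + antidiagonal i (λ k c → antidiagonal k (λ a b → F (suc a) b c)))
      ≈⟨ +-congˡ (+-congˡ (antidiagonal-assoc i (λ a → F (suc a)))) ⟩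
    F 0 0 (suc i) + (antidiagonal i (λ k c → F 0 (suc k) c)
                     + antidiagonal i (λ a r → antidiagonal r (λ b c → F (suc a) b c)))
      ≈⟨ +-assoc _ _ _ ⟨
    (F 0 0 (suc i) + antidiagonal i (λ k c → F 0 (suc k) c))
      + antidiagonal i (λ a r → antidiagonal r (λ b c → F (suc a) b c))
      ≈⟨ +-congʳ (antidiagonal-sucˡ i (F 0)) ⟨
    antidiagonal (suc i) (F 0) + antidiagonal i (λ a r → antidiagonal r (λ b c → F (suc a) b c))
      ≈⟨ antidiagonal-sucˡ i (λ a r → antidiagonal r (λ b c → F a b c)) ⟨
    antidiagonal (suc i) (λ a r → antidiagonal r (λ b c → F a b c)) ∎

  antidiagonal-zeroˡ : ∀ i (g : ℕ → Carrier) → antidiagonal i (λ a b → 0# * g b) ≈ 0#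
  antidiagonal-zeroˡ i g = trans (antidiagonal-cong i (λ a b → zeroˡ (g b))) (∑≤-0# i)

  FPS : Set c
  FPS = ℕ → Carrier

  infix  4 _≋_
  infixl 6 _⊕_
  infixl 7 _⊛_

  _≋_ : FPS → FPS → Set ℓ
  f ≋ g = ∀ i → f i ≈ g i

  _⊕_ : FPS → FPS → FPS
  (f ⊕ g) i = f i + g i

  ⊝_ : FPS → FPS
  (⊝ f) i = - f i

  𝟘 𝟙 : FPS
  𝟘 _ = 0#
  𝟙 zero    = 1#
  𝟙 (suc _) = 0#

  _⊛_ : FPS → FPS → FPS
  (f ⊛ g) i = antidiagonal i (λ a b → f a * g b)

  ⊛-cong : ∀ {f f′ g g′} → f ≋ f′ → g ≋ g′ → f ⊛ g ≋ f′ ⊛ g′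
  ⊛-cong f≋f′ g≋g′ i = antidiagonal-cong i (λ a b → *-cong (f≋f′ a) (g≋g′ b))

  ⊛-comm : ∀ f g → f ⊛ g ≋ g ⊛ f
  ⊛-comm f g i =
    trans (antidiagonal-swap i (λ a b → f a * g b)) (antidiagonal-cong i (λ a b → *-comm (f b) (g a)))

  ⊛-assoc : ∀ f g h → (f ⊛ g) ⊛ h ≋ f ⊛ (g ⊛ h)
  ⊛-assoc f g h i = begin
    antidiagonal i (λ k c → antidiagonal k (λ a b → f a * g b) * h c)
      ≈⟨ antidiagonal-cong i (λ k c → *-distribʳ-∑≤ k (h c) (λ a → f a * g (k ∸ a))) ⟩
    antidiagonal i (λ k c → antidiagonal k (λ a b → (f a * g b) * h c))
      ≈⟨ antidiagonal-assoc i (λ a b c → (f a * g b) * h c) ⟩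
    antidiagonal i (λ a r → antidiagonal r (λ b c → (f a * g b) * h c))
      ≈⟨ antidiagonal-cong i (λ a r → ∑≤-cong r (λ k → *-assoc (f a) (g k) (h (r ∸ k)))) ⟩
    antidiagonal i (λ a r → antidiagonal r (λ b c → f a * (g b * h c)))
      ≈⟨ antidiagonal-cong i (λ a r → *-distribˡ-∑≤ r (f a) (λ b → g b * h (r ∸ b))) ⟨
    antidiagonal i (λ a r → f a * antidiagonal r (λ b c → g b * h c)) ∎

  ⊛-identityˡ : ∀ g → 𝟙 ⊛ g ≋ g
  ⊛-identityˡ g zero    = *-identityˡ _
  ⊛-identityˡ g (suc i) = begin
    antidiagonal (suc i) (λ a b → 𝟙 a * g b)          ≈⟨ antidiagonal-sucˡ i (λ a b → 𝟙 a * g b) ⟩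
    1# * g (suc i) + antidiagonal i (λ a b → 0# * g b) ≈⟨ +-cong (*-identityˡ _) (antidiagonal-zeroˡ i g) ⟩
    g (suc i) + 0#                                     ≈⟨ +-identityʳ _ ⟩
    g (suc i)                                          ∎

  ⊛-distribˡ : ∀ f g h → f ⊛ (g ⊕ h) ≋ f ⊛ g ⊕ f ⊛ h
  ⊛-distribˡ f g h i =
    trans (antidiagonal-cong i (λ a b → distribˡ (f a) (g b) (h b)))
          (antidiagonal-+ i (λ a b → f a * g b) (λ a b → f a * h b))

  fpsRing : CommutativeRing c ℓ
  fpsRing = record
    { Carrier = FPS ; _≈_ = _≋_ ; _+_ = _⊕_ ; _*_ = _⊛_ ; -_ = ⊝_ ; 0# = 𝟘 ; 1# = 𝟙
    ; isCommutativeRing = record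
      { isRing = record
        { +-isAbelianGroup = record
          { isGroup = record
            { isMonoid = record
              { isSemigroup = record
                { isMagma = record
                  { isEquivalence = record
                    { refl = λ _ → ≈-refl ; sym = λ p i → sym (p i) ; trans = λ p q i → trans (p i) (q i) }
                  ; ∙-cong = λ p q i → +-cong (p i) (q i) }
                ; assoc = λ f g h i → +-assoc (f i) (g i) (h i) }
              ; identity = (λ f i → +-identityˡ (f i)) , (λ f i → +-identityʳ (f i)) }
            ; inverse = (λ f i → -‿inverseˡ (f i)) , (λ f i → -‿inverseʳ (f i))
            ; ⁻¹-cong = λ p i → -‿cong (p i) }
          ; comm = λ f g i → +-comm (f i) (g i) }
        ; *-cong = ⊛-cong
        ; *-assoc = ⊛-assoc
        ; *-identity = ⊛-identityˡ , λ g i → trans (⊛-comm g 𝟙 i) (⊛-identityˡ g i)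
        ; distrib = ⊛-distribˡ
                  , λ f g h i → trans (⊛-comm (g ⊕ h) f i)
                                  (trans (⊛-distribˡ f g h i) (+-cong (⊛-comm f g i) (⊛-comm f h i))) }
      ; *-comm = ⊛-comm } }

  monomial : ℕ → Carrier → FPS
  monomial zero    x zero    = x
  monomial zero    x (suc _) = 0#
  monomial (suc a) x zero    = 0#
  monomial (suc a) x (suc i) = monomial a x i

  shift : ℕ → Carrier → FPS → FPS
  shift zero    x g i       = x * g i
  shift (suc a) x g zero    = 0#
  shift (suc a) x g (suc i) = shift a x g i

  monomial-⊛ : ∀ a x g → monomial a x ⊛ g ≋ shift a x g
  monomial-⊛ zero    x g zero    = ≈-refl
  monomial-⊛ zero    x g (suc i) = begin
    antidiagonal (suc i) (λ k b → monomial 0 x k * g b)  ≈⟨ antidiagonal-sucˡ i (λ k b → monomial 0 x k * g b) ⟩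
    x * g (suc i) + antidiagonal i (λ k b → 0# * g b)    ≈⟨ +-congˡ (antidiagonal-zeroˡ i g) ⟩
    x * g (suc i) + 0#                                   ≈⟨ +-identityʳ _ ⟩
    x * g (suc i)                                        ∎
  monomial-⊛ (suc a) x g zero    = zeroˡ (g 0)
  monomial-⊛ (suc a) x g (suc i) = begin
    antidiagonal (suc i) (λ k b → monomial (suc a) x k * g b)  ≈⟨ antidiagonal-sucˡ i (λ k b → monomial (suc a) x k * g b) ⟩
    0# * g (suc i) + (monomial a x ⊛ g) i                      ≈⟨ +-cong (zeroˡ _) (monomial-⊛ a x g i) ⟩
    0# + shift a x g i                                         ≈⟨ +-identityˡ _ ⟩
    shift a x g i                                              ∎

  shift-≥ : ∀ a x g {i} → a ≤ i → shift a x g i ≈ x * g (i ∸ a)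
  shift-≥ zero    x g         _         = ≈-refl
  shift-≥ (suc a) x g {suc i} (s≤s a≤i) = shift-≥ a x g a≤i

  shift-< : ∀ a x g {i} → i < a → shift a x g i ≈ 0#
  shift-< (suc a) x g {zero}  _         = ≈-refl
  shift-< (suc a) x g {suc i} (s≤s i<a) = shift-< a x g i<a

  monomial-cong : ∀ a {x y} → x ≈ y → monomial a x ≋ monomial a y
  monomial-cong zero    x≈y zero    = x≈y
  monomial-cong zero    x≈y (suc i) = ≈-refl
  monomial-cong (suc a) x≈y zero    = ≈-refl
  monomial-cong (suc a) x≈y (suc i) = monomial-cong a x≈y i

  shift-monomial : ∀ a x b y → shift a x (monomial b y) ≋ monomial (a ℕ.+ b) (x * y)
  shift-monomial zero    x zero    y zero    = ≈-refl
  shift-monomial zero    x zero    y (suc i) = zeroʳ x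
  shift-monomial zero    x (suc b) y zero    = zeroʳ x
  shift-monomial zero    x (suc b) y (suc i) = shift-monomial zero x b y i
  shift-monomial (suc a) x b       y zero    = ≈-refl
  shift-monomial (suc a) x b       y (suc i) = shift-monomial a x b y i

  monomial-⊛-monomial : ∀ a x b y → monomial a x ⊛ monomial b y ≋ monomial (a ℕ.+ b) (x * y)
  monomial-⊛-monomial a x b y i = trans (monomial-⊛ a x (monomial b y) i) (shift-monomial a x b y i)

-- Bivariate series as ℤ⟦y⟧⟦x⟧

module ℤ⟦y⟧ = FormalPowerSeries ℤ.+-*-commutativeRing
module ℤ⟦y⟧⟦x⟧ = FormalPowerSeries ℤ⟦y⟧.fpsRing
open ℤ⟦y⟧⟦x⟧ using (_⊛_; 𝟙)

seriesRing : CommutativeRing _ _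
seriesRing = ℤ⟦y⟧⟦x⟧.fpsRing

open CommutativeRing seriesRing
  using (_≈_; _-_; setoid; +-cong; +-congˡ; -‿cong; *-cong; *-congˡ; *-congʳ; *-assoc; *-comm;
         *-identityˡ; *-identityʳ; distribˡ; ring; *-commutativeSemigroup; *-commutativeMonoid)
  renaming (refl to ≈-refl; sym to ≈-sym; trans to ≈-trans)
open import Algebra.Properties.Ring ring using (-‿distribʳ-*)
open import Algebra.Properties.CommutativeSemigroup *-commutativeSemigroup using (interchange)
import Relation.Binary.Reasoning.Setoid setoid as ≈-Reasoning

infix 30 X^_Y^_

X^_Y^_ : ℕ → ℕ → Series
X^ a Y^ b = ℤ⟦y⟧⟦x⟧.monomial a (ℤ⟦y⟧.monomial b 1ℤ)

sumUpTo-cong : ∀ n {f g : ℕ → ℤ} → (∀ k → f k ≡ g k) → sumUpTo n f ≡ sumUpTo n g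
sumUpTo-cong zero    f≡g = f≡g 0
sumUpTo-cong (suc n) f≡g = cong₂ ℤ._+_ (sumUpTo-cong n f≡g) (f≡g (suc n))

∑≤≡sumUpTo : ∀ n f → ℤ⟦y⟧.∑≤ n f ≡ sumUpTo n f
∑≤≡sumUpTo zero    f = refl
∑≤≡sumUpTo (suc n) f = cong (ℤ._+ f (suc n)) (∑≤≡sumUpTo n f)

∑≤≡sumUpTo-coeff : ∀ n F j → ℤ⟦y⟧⟦x⟧.∑≤ n F j ≡ sumUpTo n (λ k → F k j)
∑≤≡sumUpTo-coeff zero    F j = refl
∑≤≡sumUpTo-coeff (suc n) F j = cong (ℤ._+ F (suc n) j) (∑≤≡sumUpTo-coeff n F j)

*S≈⊛ : ∀ f g → (f *S g) ≈ (f ⊛ g)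
*S≈⊛ f g i j = ≡.sym (≡.trans (∑≤≡sumUpTo-coeff i _ j) (sumUpTo-cong i (λ k → ∑≤≡sumUpTo j _)))

oneS≈𝟙 : oneS ≈ 𝟙
oneS≈𝟙 zero    zero    = refl
oneS≈𝟙 zero    (suc j) = refl
oneS≈𝟙 (suc i) j       = refl

mono≈X^Y^ : ∀ a b → mono a b ≈ X^ a Y^ b
mono≈X^Y^ zero    zero    zero    zero    = refl
mono≈X^Y^ zero    zero    zero    (suc j) = refl
mono≈X^Y^ zero    zero    (suc i) j       = refl
mono≈X^Y^ zero    (suc b) zero    zero    = refl
mono≈X^Y^ zero    (suc b) zero    (suc j) = mono≈X^Y^ zero b zero j
mono≈X^Y^ zero    (suc b) (suc i) j       = refl
mono≈X^Y^ (suc a) b       zero    j       = refl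
mono≈X^Y^ (suc a) b       (suc i) j       = mono≈X^Y^ a b i j

X^Y^-⊛-X^Y^ : ∀ a b c d → (X^ a Y^ b ⊛ X^ c Y^ d) ≈ X^ (a ℕ.+ c) Y^ (b ℕ.+ d)
X^Y^-⊛-X^Y^ a b c d i j =
  ≡.trans (ℤ⟦y⟧⟦x⟧.monomial-⊛-monomial a _ c _ i j)
          (ℤ⟦y⟧⟦x⟧.monomial-cong (a ℕ.+ c) (ℤ⟦y⟧.monomial-⊛-monomial b 1ℤ d 1ℤ) i j)

X^Y^-⊛-≥ : ∀ a b g {i j} → a ≤ i → b ≤ j → (X^ a Y^ b ⊛ g) i j ≡ g (i ∸ a) (j ∸ b)
X^Y^-⊛-≥ a b g {i} {j} a≤i b≤j = begin
  (X^ a Y^ b ⊛ g) i j                                   ≡⟨ ℤ⟦y⟧⟦x⟧.monomial-⊛ a _ g i j ⟩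
  ℤ⟦y⟧⟦x⟧.shift a (ℤ⟦y⟧.monomial b 1ℤ) g i j           ≡⟨ ℤ⟦y⟧⟦x⟧.shift-≥ a _ g a≤i j ⟩
  ℤ⟦y⟧._⊛_ (ℤ⟦y⟧.monomial b 1ℤ) (g (i ∸ a)) j           ≡⟨ ℤ⟦y⟧.monomial-⊛ b 1ℤ (g (i ∸ a)) j ⟩
  ℤ⟦y⟧.shift b 1ℤ (g (i ∸ a)) j                         ≡⟨ ℤ⟦y⟧.shift-≥ b 1ℤ (g (i ∸ a)) b≤j ⟩
  1ℤ ℤ.* g (i ∸ a) (j ∸ b)                              ≡⟨ ℤ.*-identityˡ _ ⟩
  g (i ∸ a) (j ∸ b)                                     ∎
  where open ≡.≡-Reasoning

X^Y^-⊛-≱ : ∀ a b g {i j} → ¬ (a ≤ i × b ≤ j) → (X^ a Y^ b ⊛ g) i j ≡ 0ℤ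
X^Y^-⊛-≱ a b g {i} {j} ≱ with a ℕ.≤? i
... | no a≰i = ≡.trans (ℤ⟦y⟧⟦x⟧.monomial-⊛ a _ g i j) (ℤ⟦y⟧⟦x⟧.shift-< a _ g (ℕ.≰⇒> a≰i) j)
... | yes a≤i with b ℕ.≤? j
...   | yes b≤j = ⊥-elim (≱ (a≤i , b≤j))
...   | no b≰j =
  ≡.trans (ℤ⟦y⟧⟦x⟧.monomial-⊛ a _ g i j)
  (≡.trans (ℤ⟦y⟧⟦x⟧.shift-≥ a _ g a≤i j)
  (≡.trans (ℤ⟦y⟧.monomial-⊛ b 1ℤ (g (i ∸ a)) j) (ℤ⟦y⟧.shift-< b 1ℤ (g (i ∸ a)) (ℕ.≰⇒> b≰j))))

-- Weighted classes and their generating functions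

concatUpTo : {A : Set} → ℕ → (ℕ → List A) → List A
concatUpTo zero    F = F 0
concatUpTo (suc n) F = concatUpTo n F ++ F (suc n)

length-concatUpTo : {A : Set} → ∀ n (F : ℕ → List A) →
                    + length (concatUpTo n F) ≡ sumUpTo n (λ k → + length (F k))
length-concatUpTo zero    F = refl
length-concatUpTo (suc n) F = begin
  + length (concatUpTo n F ++ F (suc n))                  ≡⟨ cong +_ (length-++ (concatUpTo n F)) ⟩
  + (length (concatUpTo n F) ℕ.+ length (F (suc n)))      ≡⟨ ℤ.pos-+ (length (concatUpTo n F)) _ ⟩
  + length (concatUpTo n F) ℤ.+ + length (F (suc n))      ≡⟨ cong (ℤ._+ + length (F (suc n))) (length-concatUpTo n F) ⟩
  sumUpTo (suc n) (λ k → + length (F k))                  ∎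
  where open ≡.≡-Reasoning

∈-concatUpTo⁻ : {A : Set} → ∀ n (F : ℕ → List A) {x} → x ∈ concatUpTo n F → Σ ℕ λ k → k ≤ n × x ∈ F k
∈-concatUpTo⁻ zero    F x∈ = 0 , z≤n , x∈
∈-concatUpTo⁻ (suc n) F x∈ with ∈-++⁻ (concatUpTo n F) x∈
... | inj₁ x∈ˡ = let k , k≤n , x∈Fk = ∈-concatUpTo⁻ n F x∈ˡ in k , ℕ.m≤n⇒m≤1+n k≤n , x∈Fk
... | inj₂ x∈ʳ = suc n , ℕ.≤-refl , x∈ʳ

∈-concatUpTo⁺ : {A : Set} → ∀ n (F : ℕ → List A) {x k} → k ≤ n → x ∈ F k → x ∈ concatUpTo n F
∈-concatUpTo⁺ zero    F z≤n x∈ = x∈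
∈-concatUpTo⁺ (suc n) F {k = k} k≤1+n x∈ with k ℕ.≟ suc n
... | yes refl = ∈-++⁺ʳ (concatUpTo n F) x∈
... | no k≢1+n = ∈-++⁺ˡ (∈-concatUpTo⁺ n F (ℕ.≤-pred (ℕ.≤∧≢⇒< k≤1+n k≢1+n)) x∈)

concatUpTo-unique : {A : Set} → ∀ n (F : ℕ → List A) → (∀ k → Unique (F k)) →
                    (∀ {k k′ x} → x ∈ F k → x ∈ F k′ → k ≡ k′) → Unique (concatUpTo n F)
concatUpTo-unique zero    F unique disjoint = unique 0
concatUpTo-unique (suc n) F unique disjoint =
  Unique.++⁺ (concatUpTo-unique n F unique disjoint) (unique (suc n)) λ (x∈ˡ , x∈ʳ) →
    let k , k≤n , x∈Fk = ∈-concatUpTo⁻ n F x∈ˡ in ℕ.<-irrefl (disjoint x∈Fk x∈ʳ) (s≤s k≤n)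

length-cartesianProduct : {A B : Set} (xs : List A) (ys : List B) →
                          length (cartesianProduct xs ys) ≡ length xs ℕ.* length ys
length-cartesianProduct []       ys = refl
length-cartesianProduct (x ∷ xs) ys =
  ≡.trans (length-++ (map (x ,_) ys)) (cong₂ ℕ._+_ (length-map _ ys) (length-cartesianProduct xs ys))

record WeightedClass : Set₁ where
  field
    Obj           : Set
    wx wy         : Obj → ℕ
    enum          : ℕ → ℕ → List Obj
    enum-unique   : ∀ i j → Unique (enum i j)
    enum-sound    : ∀ {t i j} → t ∈ enum i j → wx t ≡ i × wy t ≡ j
    enum-complete : ∀ t → t ∈ enum (wx t) (wy t)

open WeightedClass

gf : WeightedClass → Series
gf C i j = + length (enum C i j)

infixl 7 _×ᶜ_

_×ᶜ_ : WeightedClass → WeightedClass → WeightedClass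
C ×ᶜ D = record
  { Obj           = Obj C × Obj D
  ; wx            = λ (s , t) → wx C s ℕ.+ wx D t
  ; wy            = λ (s , t) → wy C s ℕ.+ wy D t
  ; enum          = pairs
  ; enum-unique   = unique
  ; enum-sound    = sound
  ; enum-complete = complete
  }
  where
  block : ℕ → ℕ → ℕ → ℕ → List (Obj C × Obj D)
  block i j k l = cartesianProduct (enum C k l) (enum D (i ∸ k) (j ∸ l))

  pairs : ℕ → ℕ → List (Obj C × Obj D)
  pairs i j = concatUpTo i (λ k → concatUpTo j (block i j k))

  block-weight : ∀ {i j k l s t} → (s , t) ∈ block i j k l → wx C s ≡ k × wy C s ≡ l
  block-weight {i} {j} {k} {l} st∈ = enum-sound C (proj₁ (∈-cartesianProduct⁻ (enum C k l) _ st∈))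

  unique : ∀ i j → Unique (pairs i j)
  unique i j =
    concatUpTo-unique i _
      (λ k → concatUpTo-unique j _ (λ l → Unique.cartesianProduct⁺ (enum-unique C k l) (enum-unique D _ _))
               λ st∈ st∈′ → ≡.trans (≡.sym (proj₂ (block-weight st∈))) (proj₂ (block-weight st∈′)))
      λ st∈ st∈′ →
        let _ , _ , st∈b  = ∈-concatUpTo⁻ j _ st∈
            _ , _ , st∈b′ = ∈-concatUpTo⁻ j _ st∈′
        in ≡.trans (≡.sym (proj₁ (block-weight st∈b))) (proj₁ (block-weight st∈b′))

  sound : ∀ {st i j} → st ∈ pairs i j →
          wx C (proj₁ st) ℕ.+ wx D (proj₂ st) ≡ i × wy C (proj₁ st) ℕ.+ wy D (proj₂ st) ≡ j
  sound {s , t} {i} {j} st∈ =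
    let k , k≤i , st∈′ = ∈-concatUpTo⁻ i _ st∈
        l , l≤j , st∈b = ∈-concatUpTo⁻ j _ st∈′
        s∈ , t∈        = ∈-cartesianProduct⁻ (enum C k l) _ st∈b
        sx , sy        = enum-sound C s∈
        tx , ty        = enum-sound D t∈
    in ≡.trans (cong₂ ℕ._+_ sx tx) (ℕ.m+[n∸m]≡n k≤i) , ≡.trans (cong₂ ℕ._+_ sy ty) (ℕ.m+[n∸m]≡n l≤j)

  complete : ∀ st → st ∈ pairs (wx C (proj₁ st) ℕ.+ wx D (proj₂ st)) (wy C (proj₁ st) ℕ.+ wy D (proj₂ st))
  complete (s , t) =
    ∈-concatUpTo⁺ _ _ (ℕ.m≤m+n (wx C s) (wx D t))
      (∈-concatUpTo⁺ _ _ (ℕ.m≤m+n (wy C s) (wy D t))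
        (∈-cartesianProduct⁺ (enum-complete C s)
          (subst₂ (λ u v → t ∈ enum D u v)
                  (≡.sym (ℕ.m+n∸m≡n (wx C s) (wx D t))) (≡.sym (ℕ.m+n∸m≡n (wy C s) (wy D t)))
                  (enum-complete D t))))

gf-×ᶜ : ∀ C D → gf (C ×ᶜ D) ≈ (gf C *S gf D)
gf-×ᶜ C D i j =
  ≡.trans (length-concatUpTo i _) (sumUpTo-cong i λ k →
  ≡.trans (length-concatUpTo j _) (sumUpTo-cong j λ l →
  ≡.trans (cong +_ (length-cartesianProduct (enum C k l) _)) (ℤ.pos-* (length (enum C k l)) _)))

onlyIf : Bool → List ⊤
onlyIf c = if c then tt ∷ [] else []

∈-onlyIf⁻ : ∀ c → tt ∈ onlyIf c → T c
∈-onlyIf⁻ true _ = tt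

∈-onlyIf⁺ : ∀ c → T c → tt ∈ onlyIf c
∈-onlyIf⁺ true _ = here refl

onlyIf-unique : ∀ c → Unique (onlyIf c)
onlyIf-unique true  = All.[] ∷ []
onlyIf-unique false = []

length-onlyIf : ∀ c → + length (onlyIf c) ≡ (if c then 1ℤ else 0ℤ)
length-onlyIf true  = refl
length-onlyIf false = refl

point : ℕ → ℕ → WeightedClass
point a b = record
  { Obj           = ⊤
  ; wx            = λ _ → a
  ; wy            = λ _ → b
  ; enum          = λ i j → onlyIf ((i ≡ᵇ a) ∧ (j ≡ᵇ b))
  ; enum-unique   = λ i j → onlyIf-unique ((i ≡ᵇ a) ∧ (j ≡ᵇ b))
  ; enum-sound    = λ {_} {i} {j} tt∈ →
      let i≡a , j≡b = Equivalence.to T-∧ (∈-onlyIf⁻ ((i ≡ᵇ a) ∧ (j ≡ᵇ b)) tt∈)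
      in ≡.sym (ℕ.≡ᵇ⇒≡ i a i≡a) , ≡.sym (ℕ.≡ᵇ⇒≡ j b j≡b)
  ; enum-complete = λ _ → ∈-onlyIf⁺ ((a ≡ᵇ a) ∧ (b ≡ᵇ b))
                            (Equivalence.from T-∧ (ℕ.≡⇒≡ᵇ a a refl , ℕ.≡⇒≡ᵇ b b refl))
  }

gf-point : ∀ a b → gf (point a b) ≈ mono a b
gf-point a b i j = length-onlyIf ((i ≡ᵇ a) ∧ (j ≡ᵇ b))

module Geometric (a b : ℕ) .{{_ : NonZero a}} where

  OnRay : ℕ → ℕ → Set
  OnRay i j = Σ ℕ λ d → a ℕ.* d ≡ i × b ℕ.* d ≡ j

  onRay? : ∀ i j → Dec (OnRay i j)
  onRay? i j = map′ (λ (p , q) → i / a , p , q) quotient-on-ray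
                    ((a ℕ.* (i / a) ℕ.≟ i) ×-dec (b ℕ.* (i / a) ℕ.≟ j))
    where
    quotient-on-ray : OnRay i j → a ℕ.* (i / a) ≡ i × b ℕ.* (i / a) ≡ j
    quotient-on-ray (d , refl , refl) = cong (a ℕ.*_) ad/a≡d , cong (b ℕ.*_) ad/a≡d
      where
      ad/a≡d : a ℕ.* d / a ≡ d
      ad/a≡d = ≡.trans (cong (_/ a) (ℕ.*-comm a d)) (m*n/n≡m d a)

  rayPoint : ∀ {i j} → Dec (OnRay i j) → List ℕ
  rayPoint (yes (d , _)) = d ∷ []
  rayPoint (no _)        = []

  geometric : WeightedClass
  geometric = record
    { Obj           = ℕ
    ; wx            = a ℕ.*_
    ; wy            = b ℕ.*_
    ; enum          = λ i j → rayPoint (onRay? i j)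
    ; enum-unique   = λ i j → unique (onRay? i j)
    ; enum-sound    = λ {_} {i} {j} → sound (onRay? i j)
    ; enum-complete = complete
    }
    where
    unique : ∀ {i j} (r : Dec (OnRay i j)) → Unique (rayPoint r)
    unique (yes _) = All.[] ∷ []
    unique (no _)  = []

    sound : ∀ {t i j} (r : Dec (OnRay i j)) → t ∈ rayPoint r → a ℕ.* t ≡ i × b ℕ.* t ≡ j
    sound (yes (d , ad≡i , bd≡j)) (here refl) = ad≡i , bd≡j

    complete : ∀ t → t ∈ rayPoint (onRay? (a ℕ.* t) (b ℕ.* t))
    complete t with onRay? (a ℕ.* t) (b ℕ.* t)
    ... | yes (d , ad≡at , _) = here (ℕ.*-cancelˡ-≡ t d a (≡.sym ad≡at))
    ... | no ¬onRay           = ⊥-elim (¬onRay (t , refl , refl))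

  gf-onRay : ∀ {i j} → OnRay i j → gf geometric i j ≡ 1ℤ
  gf-onRay {i} {j} onRay with onRay? i j
  ... | yes _     = refl
  ... | no ¬onRay = ⊥-elim (¬onRay onRay)

  gf-offRay : ∀ {i j} → ¬ OnRay i j → gf geometric i j ≡ 0ℤ
  gf-offRay {i} {j} ¬onRay with onRay? i j
  ... | yes onRay = ⊥-elim (¬onRay onRay)
  ... | no _      = refl

  onRay-pred : ∀ {i j} → ¬ (i ≡ 0 × j ≡ 0) → OnRay i j → a ≤ i × b ≤ j × OnRay (i ∸ a) (j ∸ b)
  onRay-pred ≢origin (zero , refl , refl) = ⊥-elim (≢origin (ℕ.*-zeroʳ a , ℕ.*-zeroʳ b))
  onRay-pred ≢origin (suc d , refl , refl) =
    subst (a ≤_) (≡.sym (ℕ.*-suc a d)) (ℕ.m≤m+n a (a ℕ.* d)) ,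
    subst (b ≤_) (≡.sym (ℕ.*-suc b d)) (ℕ.m≤m+n b (b ℕ.* d)) ,
    d , ≡.sym (≡.trans (cong (_∸ a) (ℕ.*-suc a d)) (ℕ.m+n∸m≡n a (a ℕ.* d)))
      , ≡.sym (≡.trans (cong (_∸ b) (ℕ.*-suc b d)) (ℕ.m+n∸m≡n b (b ℕ.* d)))

  onRay-suc : ∀ {i j} → a ≤ i → b ≤ j → OnRay (i ∸ a) (j ∸ b) → OnRay i j
  onRay-suc a≤i b≤j (d , ad≡ , bd≡) =
    suc d , ≡.trans (ℕ.*-suc a d) (≡.trans (cong (a ℕ.+_) ad≡) (ℕ.m+[n∸m]≡n a≤i))
          , ≡.trans (ℕ.*-suc b d) (≡.trans (cong (b ℕ.+_) bd≡) (ℕ.m+[n∸m]≡n b≤j))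

  gf-geometric-pred : ∀ {i j} → ¬ (i ≡ 0 × j ≡ 0) → a ≤ i → b ≤ j →
                      gf geometric i j ≡ gf geometric (i ∸ a) (j ∸ b)
  gf-geometric-pred ≢origin a≤i b≤j with onRay? _ _
  ... | yes onRay = ≡.trans (gf-onRay (onRay-suc a≤i b≤j onRay)) (≡.sym (gf-onRay onRay))
  ... | no ¬onRay = ≡.trans (gf-offRay (¬onRay ∘ proj₂ ∘ proj₂ ∘ onRay-pred ≢origin)) (≡.sym (gf-offRay ¬onRay))

  gf-geometric-step : ∀ {i j} → ¬ (i ≡ 0 × j ≡ 0) → gf geometric i j ≡ (X^ a Y^ b ⊛ gf geometric) i j
  gf-geometric-step {i} {j} ≢origin with (a ℕ.≤? i) ×-dec (b ℕ.≤? j)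
  ... | yes (a≤i , b≤j) =
    ≡.trans (gf-geometric-pred ≢origin a≤i b≤j) (≡.sym (X^Y^-⊛-≥ a b (gf geometric) a≤i b≤j))
  ... | no ≱ =
    ≡.trans (gf-offRay λ onRay → ≱ (let a≤i , b≤j , _ = onRay-pred ≢origin onRay in a≤i , b≤j))
            (≡.sym (X^Y^-⊛-≱ a b (gf geometric) ≱))

  gf-geometric-origin : gf geometric 0 0 ≡ 1ℤ
  gf-geometric-origin = gf-onRay (0 , ℕ.*-zeroʳ a , ℕ.*-zeroʳ b)

  gf-geometric-recurrence : ∀ i j → gf geometric i j ℤ.- (X^ a Y^ b ⊛ gf geometric) i j ≡ 𝟙 i j
  gf-geometric-recurrence zero    zero    =
    cong₂ ℤ._-_ gf-geometric-origin
                (X^Y^-⊛-≱ a b (gf geometric) {0} {0} λ (a≤0 , _) → ℕ.<⇒≱ (ℕ.>-nonZero⁻¹ a) a≤0)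
  gf-geometric-recurrence zero    (suc j) = ℤ.i≡j⇒i-j≡0 (gf-geometric-step {0} {suc j} λ ())
  gf-geometric-recurrence (suc i) j       = ℤ.i≡j⇒i-j≡0 (gf-geometric-step {suc i} {j} λ ())

  geometric-inverse : gf geometric ⊛ (𝟙 - X^ a Y^ b) ≈ 𝟙
  geometric-inverse = begin
    G ⊛ (𝟙 - X^ a Y^ b)              ≈⟨ distribˡ G 𝟙 (⊝ X^ a Y^ b) ⟩
    G ⊛ 𝟙 ⊕ G ⊛ (⊝ X^ a Y^ b)        ≈⟨ +-cong (*-identityʳ G) (≈-sym (-‿distribʳ-* G (X^ a Y^ b))) ⟩
    G ⊕ ⊝ (G ⊛ X^ a Y^ b)            ≈⟨ +-congˡ {G} (-‿cong {G ⊛ X^ a Y^ b} (*-comm G (X^ a Y^ b))) ⟩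
    G - X^ a Y^ b ⊛ G                ≈⟨ gf-geometric-recurrence ⟩
    𝟙                                ∎
    where
    open ≈-Reasoning
    open ℤ⟦y⟧⟦x⟧ using (_⊕_; ⊝_)
    G : Series
    G = gf geometric

-- Inverting (x;xy)_n (x²y²;x²y²)_n

X^Y^-cong : ∀ {a b c d} → a ≡ c → b ≡ d → X^ a Y^ b ≈ X^ c Y^ d
X^Y^-cong refl refl = ≈-refl

mono-^S : ∀ a b n → (mono a b ^S n) ≈ X^ (n ℕ.* a) Y^ (n ℕ.* b)
mono-^S a b zero    = mono≈X^Y^ 0 0
mono-^S a b (suc n) = begin
  (mono a b ^S n) *S mono a b               ≈⟨ *S≈⊛ (mono a b ^S n) (mono a b) ⟩
  (mono a b ^S n) ⊛ mono a b                ≈⟨ *-cong (mono-^S a b n) (mono≈X^Y^ a b) ⟩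
  X^ (n ℕ.* a) Y^ (n ℕ.* b) ⊛ X^ a Y^ b     ≈⟨ X^Y^-⊛-X^Y^ (n ℕ.* a) (n ℕ.* b) a b ⟩
  X^ (n ℕ.* a ℕ.+ a) Y^ (n ℕ.* b ℕ.+ b)     ≈⟨ X^Y^-cong (ℕ.+-comm (n ℕ.* a) a) (ℕ.+-comm (n ℕ.* b) b) ⟩
  X^ (suc n ℕ.* a) Y^ (suc n ℕ.* b)         ∎
  where open ≈-Reasoning

poch-suc : ∀ a b c d n → poch (mono a b) (mono c d) (suc n) ≈
           poch (mono a b) (mono c d) n ⊛ (𝟙 - X^ (a ℕ.+ n ℕ.* c) Y^ (b ℕ.+ n ℕ.* d))
poch-suc a b c d n =
  ≈-trans (*S≈⊛ (poch (mono a b) (mono c d) n) (oneS -S (mono a b *S (mono c d ^S n))))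
          (*-congˡ {poch (mono a b) (mono c d) n} factor)
  where
  factor : (oneS -S (mono a b *S (mono c d ^S n))) ≈ 𝟙 - X^ (a ℕ.+ n ℕ.* c) Y^ (b ℕ.+ n ℕ.* d)
  factor i j = cong₂ ℤ._-_ (oneS≈𝟙 i j)
    (≈-trans (*S≈⊛ (mono a b) (mono c d ^S n))
      (≈-trans (*-cong (mono≈X^Y^ a b) (mono-^S c d n)) (X^Y^-⊛-X^Y^ a b (n ℕ.* c) (n ℕ.* d))) i j)

denom-suc : ∀ n → denom (suc n) ≈
            (denom n ⊛ (𝟙 - X^ (suc n) Y^ n)) ⊛ (𝟙 - X^ (2 ℕ.* suc n) Y^ (2 ℕ.* suc n))
denom-suc n = begin
  denom (suc n)                                  ≈⟨ *S≈⊛ (p₁ (suc n)) (p₂ (suc n)) ⟩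
  p₁ (suc n) ⊛ p₂ (suc n)                        ≈⟨ *-cong (poch-suc 1 0 1 1 n) (poch-suc 2 2 2 2 n) ⟩
  (p₁ n ⊛ (𝟙 - X^ (1 ℕ.+ n ℕ.* 1) Y^ (n ℕ.* 1))) ⊛ (p₂ n ⊛ (𝟙 - X^ (2 ℕ.+ n ℕ.* 2) Y^ (2 ℕ.+ n ℕ.* 2)))
    ≈⟨ *-cong (*-congˡ {p₁ n} (𝟙-‿cong (X^Y^-cong (cong suc (ℕ.*-identityʳ n)) (ℕ.*-identityʳ n))))
              (*-congˡ {p₂ n} (𝟙-‿cong (X^Y^-cong 2+2n≡2[1+n] 2+2n≡2[1+n]))) ⟩
  (p₁ n ⊛ f₁) ⊛ (p₂ n ⊛ f₂)                      ≈⟨ *-assoc (p₁ n) f₁ (p₂ n ⊛ f₂) ⟩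
  p₁ n ⊛ (f₁ ⊛ (p₂ n ⊛ f₂))                      ≈⟨ *-congˡ {p₁ n} (x∙yz≈y∙xz f₁ (p₂ n) f₂) ⟩
  p₁ n ⊛ (p₂ n ⊛ (f₁ ⊛ f₂))                      ≈⟨ *-assoc (p₁ n) (p₂ n) (f₁ ⊛ f₂) ⟨
  (p₁ n ⊛ p₂ n) ⊛ (f₁ ⊛ f₂)                      ≈⟨ *-congʳ {f₁ ⊛ f₂} (*S≈⊛ (p₁ n) (p₂ n)) ⟨
  denom n ⊛ (f₁ ⊛ f₂)                            ≈⟨ *-assoc (denom n) f₁ f₂ ⟨
  (denom n ⊛ f₁) ⊛ f₂                            ∎
  where
  open ≈-Reasoning
  open import Algebra.Properties.CommutativeSemigroup *-commutativeSemigroup using (x∙yz≈y∙xz)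
  p₁ p₂ : ℕ → Series
  p₁ = poch (mono 1 0) (mono 1 1)
  p₂ = poch (mono 2 2) (mono 2 2)
  f₁ f₂ : Series
  f₁ = 𝟙 - X^ (suc n) Y^ n
  f₂ = 𝟙 - X^ (2 ℕ.* suc n) Y^ (2 ℕ.* suc n)
  𝟙-‿cong : ∀ {f g} → f ≈ g → 𝟙 - f ≈ 𝟙 - g
  𝟙-‿cong f≈g = +-congˡ {𝟙} (-‿cong f≈g)
  2+2n≡2[1+n] : 2 ℕ.+ n ℕ.* 2 ≡ 2 ℕ.* suc n
  2+2n≡2[1+n] = ≡.trans (cong (2 ℕ.+_) (ℕ.*-comm n 2)) (≡.sym (ℕ.*-suc 2 n))

gapClass : ℕ → WeightedClass
gapClass zero    = point 0 0
gapClass (suc n) =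
  gapClass n ×ᶜ Geometric.geometric (suc n) n ×ᶜ Geometric.geometric (2 ℕ.* suc n) (2 ℕ.* suc n)

gf-gapClass-inverse : ∀ n → gf (gapClass n) ⊛ denom n ≈ 𝟙
gf-gapClass-inverse zero = begin
  gf (point 0 0) ⊛ denom 0
    ≈⟨ *-cong (≈-trans (gf-point 0 0) oneS≈𝟙) (≈-trans (*S≈⊛ oneS oneS) (*-cong oneS≈𝟙 oneS≈𝟙)) ⟩
  𝟙 ⊛ (𝟙 ⊛ 𝟙)                ≈⟨ ≈-trans (*-identityˡ (𝟙 ⊛ 𝟙)) (*-identityˡ 𝟙) ⟩
  𝟙                          ∎
  where open ≈-Reasoning
gf-gapClass-inverse (suc n) = begin
  gf (gapClass (suc n)) ⊛ denom (suc n)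
    ≈⟨ *-cong gf-split (denom-suc n) ⟩
  ((Q ⊛ G₁) ⊛ G₂) ⊛ ((denom n ⊛ f₁) ⊛ f₂)
    ≈⟨ interchange (Q ⊛ G₁) G₂ (denom n ⊛ f₁) f₂ ⟩
  ((Q ⊛ G₁) ⊛ (denom n ⊛ f₁)) ⊛ (G₂ ⊛ f₂)
    ≈⟨ *-cong (interchange Q G₁ (denom n) f₁) (Geometric.geometric-inverse (2 ℕ.* suc n) (2 ℕ.* suc n)) ⟩
  ((Q ⊛ denom n) ⊛ (G₁ ⊛ f₁)) ⊛ 𝟙
    ≈⟨ *-congʳ {𝟙} (*-cong (gf-gapClass-inverse n) (Geometric.geometric-inverse (suc n) n)) ⟩
  (𝟙 ⊛ 𝟙) ⊛ 𝟙
    ≈⟨ ≈-trans (*-identityʳ (𝟙 ⊛ 𝟙)) (*-identityʳ 𝟙) ⟩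
  𝟙 ∎
  where
  open ≈-Reasoning
  geo₁ geo₂ : WeightedClass
  geo₁ = Geometric.geometric (suc n) n
  geo₂ = Geometric.geometric (2 ℕ.* suc n) (2 ℕ.* suc n)
  Q G₁ G₂ f₁ f₂ : Series
  Q  = gf (gapClass n)
  G₁ = gf geo₁
  G₂ = gf geo₂
  f₁ = 𝟙 - X^ (suc n) Y^ n
  f₂ = 𝟙 - X^ (2 ℕ.* suc n) Y^ (2 ℕ.* suc n)
  gf-split : gf (gapClass (suc n)) ≈ (Q ⊛ G₁) ⊛ G₂
  gf-split = ≈-trans (gf-×ᶜ (gapClass n ×ᶜ geo₁) geo₂)
               (≈-trans (*S≈⊛ (gf (gapClass n ×ᶜ geo₁)) G₂)
                 (*-congʳ {G₂} (≈-trans (gf-×ᶜ (gapClass n) geo₁) (*S≈⊛ Q G₁))))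

inverse-of-denom : (P : ℕ → Series) → (∀ n → (P n *S denom n) ≈S oneS) → ∀ n → P n ≈ gf (gapClass n)
inverse-of-denom P P-inverse n =
  inverse-unique *-commutativeMonoid {z = denom n}
    (≈-trans (≈-sym (*S≈⊛ (P n) (denom n))) (≈-trans (P-inverse n) oneS≈𝟙))
    (gf-gapClass-inverse n)

-- Partitions in 𝒢' as lists of pairs

half-+-double : ∀ m k → (m ℕ.+ k ℕ.* 2) / 2 ≡ m / 2 ℕ.+ k
half-+-double m k = ≡.trans (+-distrib-/-∣ʳ m (divides k refl)) (cong (m / 2 ℕ.+_) (m*n/n≡m k 2))

ex-suc : ∀ n → ex (suc n) ≡ ex n ℕ.+ 3 ℕ.* suc n
ex-suc n = begin
  3 ℕ.* ((suc n ℕ.* suc (suc n)) / 2)            ≡⟨ cong (λ m → 3 ℕ.* (m / 2)) (shape n) ⟩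
  3 ℕ.* ((n ℕ.* suc n ℕ.+ suc n ℕ.* 2) / 2)      ≡⟨ cong (3 ℕ.*_) (half-+-double (n ℕ.* suc n) (suc n)) ⟩
  3 ℕ.* ((n ℕ.* suc n) / 2 ℕ.+ suc n)            ≡⟨ ℕ.*-distribˡ-+ 3 ((n ℕ.* suc n) / 2) (suc n) ⟩
  ex n ℕ.+ 3 ℕ.* suc n                            ∎
  where
  open ≡.≡-Reasoning
  shape : ∀ n → suc n ℕ.* suc (suc n) ≡ n ℕ.* suc n ℕ.+ suc n ℕ.* 2
  shape = solve-∀

ey-suc : ∀ n → ey (suc n) ≡ ey n ℕ.+ 3 ℕ.* n
ey-suc zero    = refl
ey-suc (suc n) = begin
  3 ℕ.* ((suc (suc n) ℕ.* suc n) / 2)            ≡⟨ cong (λ m → 3 ℕ.* (m / 2)) (shape n) ⟩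
  3 ℕ.* ((suc n ℕ.* n ℕ.+ suc n ℕ.* 2) / 2)      ≡⟨ cong (3 ℕ.*_) (half-+-double (suc n ℕ.* n) (suc n)) ⟩
  3 ℕ.* ((suc n ℕ.* n) / 2 ℕ.+ suc n)            ≡⟨ ℕ.*-distribˡ-+ 3 ((suc n ℕ.* n) / 2) (suc n) ⟩
  ey (suc n) ℕ.+ 3 ℕ.* suc n                      ∎
  where
  open ≡.≡-Reasoning
  shape : ∀ n → suc (suc n) ℕ.* suc n ≡ suc n ℕ.* n ℕ.+ suc n ℕ.* 2
  shape = solve-∀

n≤ex : ∀ n → n ≤ ex n
n≤ex zero    = z≤n
n≤ex (suc n) = subst (suc n ≤_) (≡.sym (ex-suc n))
  (ℕ.≤-trans (ℕ.m≤m+n (suc n) (2 ℕ.* suc n)) (ℕ.m≤n+m (3 ℕ.* suc n) (ex n)))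

raise lower : ℕ → ℕ × ℕ → ℕ × ℕ
raise c (x , y) = x ℕ.+ c , y ℕ.+ c
lower c (x , y) = x ∸ c , y ∸ c

sumWith : (ℕ × ℕ → ℕ) → List (ℕ × ℕ) → ℕ
sumWith f ps = sum (map f ps)

sumWith-∷ʳ : ∀ f ps p → sumWith f (ps ∷ʳ p) ≡ sumWith f ps ℕ.+ f p
sumWith-∷ʳ f ps p = begin
  sum (map f (ps ∷ʳ p))              ≡⟨ cong sum (map-++ f ps (p ∷ [])) ⟩
  sum (map f ps ++ f p ∷ [])         ≡⟨ sum-++ (map f ps) (f p ∷ []) ⟩
  sumWith f ps ℕ.+ (f p ℕ.+ 0)       ≡⟨ cong (sumWith f ps ℕ.+_) (ℕ.+-identityʳ (f p)) ⟩
  sumWith f ps ℕ.+ f p               ∎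
  where open ≡.≡-Reasoning

sumWith-raise : ∀ f c → (∀ p → f (raise c p) ≡ f p ℕ.+ c) →
                ∀ ps → sumWith f (map (raise c) ps) ≡ sumWith f ps ℕ.+ length ps ℕ.* c
sumWith-raise f c f-raise []       = refl
sumWith-raise f c f-raise (p ∷ ps) =
  ≡.trans (cong₂ ℕ._+_ (f-raise p) (sumWith-raise f c f-raise ps))
          (regroup (f p) c (sumWith f ps) (length ps))
  where
  regroup : ∀ x c s l → (x ℕ.+ c) ℕ.+ (s ℕ.+ l ℕ.* c) ≡ (x ℕ.+ s) ℕ.+ suc l ℕ.* c
  regroup = solve-∀

length-∷ʳ : {A : Set} (xs : List A) (x : A) → length (xs ∷ʳ x) ≡ suc (length xs)
length-∷ʳ xs x = ≡.trans (length-++ xs) (ℕ.+-comm (length xs) 1)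

lead : ℕ → ℕ → ℕ
lead d e = 3 ℕ.+ d ℕ.+ 2 ℕ.* e

pairsOfGaps : ∀ n → Obj (gapClass n) → List (ℕ × ℕ)
pairsOfGaps zero    _             = []
pairsOfGaps (suc n) ((q , d) , e) = map (raise (lead d e)) (pairsOfGaps n q) ∷ʳ (lead d e , 2 ℕ.* e)

length-pairsOfGaps : ∀ n q → length (pairsOfGaps n q) ≡ n
length-pairsOfGaps zero    q             = refl
length-pairsOfGaps (suc n) ((q , d) , e) =
  ≡.trans (length-∷ʳ (map (raise (lead d e)) (pairsOfGaps n q)) _)
          (cong suc (≡.trans (length-map _ (pairsOfGaps n q)) (length-pairsOfGaps n q)))

fstSum-pairsOfGaps : ∀ n q → sumWith proj₁ (pairsOfGaps n q) ≡ ex n ℕ.+ wx (gapClass n) q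
fstSum-pairsOfGaps zero    q             = refl
fstSum-pairsOfGaps (suc n) ((q , d) , e) = begin
  sumWith proj₁ (map (raise c) ps ∷ʳ (c , 2 ℕ.* e))
    ≡⟨ sumWith-∷ʳ proj₁ (map (raise c) ps) _ ⟩
  sumWith proj₁ (map (raise c) ps) ℕ.+ c
    ≡⟨ cong (ℕ._+ c) (sumWith-raise proj₁ c (λ _ → refl) ps) ⟩
  sumWith proj₁ ps ℕ.+ length ps ℕ.* c ℕ.+ c
    ≡⟨ cong₂ (λ s l → s ℕ.+ l ℕ.* c ℕ.+ c) (fstSum-pairsOfGaps n q) (length-pairsOfGaps n q) ⟩
  ex n ℕ.+ wx (gapClass n) q ℕ.+ n ℕ.* c ℕ.+ c
    ≡⟨ regroup (ex n) (wx (gapClass n) q) n d e ⟩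
  ex n ℕ.+ 3 ℕ.* suc n ℕ.+ wx (gapClass (suc n)) ((q , d) , e)
    ≡⟨ cong (ℕ._+ wx (gapClass (suc n)) ((q , d) , e)) (ex-suc n) ⟨
  ex (suc n) ℕ.+ wx (gapClass (suc n)) ((q , d) , e) ∎
  where
  open ≡.≡-Reasoning
  c : ℕ
  c = lead d e
  ps : List (ℕ × ℕ)
  ps = pairsOfGaps n q
  regroup : ∀ x w n d e → x ℕ.+ w ℕ.+ n ℕ.* (3 ℕ.+ d ℕ.+ 2 ℕ.* e) ℕ.+ (3 ℕ.+ d ℕ.+ 2 ℕ.* e)
            ≡ x ℕ.+ 3 ℕ.* suc n ℕ.+ (w ℕ.+ suc n ℕ.* d ℕ.+ 2 ℕ.* suc n ℕ.* e)
  regroup = solve-∀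

sndSum-pairsOfGaps : ∀ n q → sumWith proj₂ (pairsOfGaps n q) ≡ ey n ℕ.+ wy (gapClass n) q
sndSum-pairsOfGaps zero    q             = refl
sndSum-pairsOfGaps (suc n) ((q , d) , e) = begin
  sumWith proj₂ (map (raise c) ps ∷ʳ (c , 2 ℕ.* e))
    ≡⟨ sumWith-∷ʳ proj₂ (map (raise c) ps) _ ⟩
  sumWith proj₂ (map (raise c) ps) ℕ.+ 2 ℕ.* e
    ≡⟨ cong (ℕ._+ 2 ℕ.* e) (sumWith-raise proj₂ c (λ _ → refl) ps) ⟩
  sumWith proj₂ ps ℕ.+ length ps ℕ.* c ℕ.+ 2 ℕ.* e
    ≡⟨ cong₂ (λ s l → s ℕ.+ l ℕ.* c ℕ.+ 2 ℕ.* e) (sndSum-pairsOfGaps n q) (length-pairsOfGaps n q) ⟩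
  ey n ℕ.+ wy (gapClass n) q ℕ.+ n ℕ.* c ℕ.+ 2 ℕ.* e
    ≡⟨ regroup (ey n) (wy (gapClass n) q) n d e ⟩
  ey n ℕ.+ 3 ℕ.* n ℕ.+ wy (gapClass (suc n)) ((q , d) , e)
    ≡⟨ cong (ℕ._+ wy (gapClass (suc n)) ((q , d) , e)) (ey-suc n) ⟨
  ey (suc n) ℕ.+ wy (gapClass (suc n)) ((q , d) , e) ∎
  where
  open ≡.≡-Reasoning
  c : ℕ
  c = lead d e
  ps : List (ℕ × ℕ)
  ps = pairsOfGaps n q
  regroup : ∀ x w n d e → x ℕ.+ w ℕ.+ n ℕ.* (3 ℕ.+ d ℕ.+ 2 ℕ.* e) ℕ.+ 2 ℕ.* e
            ≡ x ℕ.+ 3 ℕ.* n ℕ.+ (w ℕ.+ n ℕ.* d ℕ.+ 2 ℕ.* suc n ℕ.* e)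
  regroup = solve-∀

-- An odd-length partition is completed by a last part 0, which flatten drops again.
flatten : List (ℕ × ℕ) → List ℕ
flattenAfter : ℕ → List (ℕ × ℕ) → List ℕ
flatten []             = []
flatten ((x , y) ∷ ps) = x ∷ flattenAfter y ps
flattenAfter y       (p ∷ ps) = y ∷ flatten (p ∷ ps)
flattenAfter zero    []       = []
flattenAfter (suc y) []       = suc y ∷ []

pairUp : List ℕ → List (ℕ × ℕ)
pairUp []           = []
pairUp (x ∷ [])     = (x , 0) ∷ []
pairUp (x ∷ y ∷ ps) = (x , y) ∷ pairUp ps

pairUp-flatten : ∀ ps → pairUp (flatten ps) ≡ ps
pairUp-flatten []                  = refl
pairUp-flatten ((x , y) ∷ p ∷ ps)  = cong ((x , y) ∷_) (pairUp-flatten (p ∷ ps))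
pairUp-flatten ((x , zero)  ∷ [])  = refl
pairUp-flatten ((x , suc y) ∷ [])  = refl

flatten-pairUp : ∀ ps → All (_≥ 1) ps → flatten (pairUp ps) ≡ ps
flatten-pairUp []                      _              = refl
flatten-pairUp (x ∷ [])                _              = refl
flatten-pairUp (x ∷ suc y ∷ [])        _              = refl
flatten-pairUp (x ∷ y ∷ ps@(_ ∷ []))    (_ ∷ _ ∷ ps≥1) = cong (λ ps′ → x ∷ y ∷ ps′) (flatten-pairUp ps ps≥1)
flatten-pairUp (x ∷ y ∷ ps@(_ ∷ _ ∷ _)) (_ ∷ _ ∷ ps≥1) = cong (λ ps′ → x ∷ y ∷ ps′) (flatten-pairUp ps ps≥1)

sums-flatten : ∀ ps → oddSum (flatten ps) ≡ sumWith proj₁ ps × evenSum (flatten ps) ≡ sumWith proj₂ ps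
sums-flatten []                 = refl , refl
sums-flatten ((x , y) ∷ p ∷ ps) = let odd , even = sums-flatten (p ∷ ps) in cong (x ℕ.+_) odd , cong (y ℕ.+_) even
sums-flatten ((x , zero)  ∷ []) = refl , refl
sums-flatten ((x , suc y) ∷ []) = refl , refl

Admissible : List (ℕ × ℕ) → Set
Admissible []                          = ⊤
Admissible ((x , y) ∷ [])              = x ≥ 3 ℕ.+ y × 2 ∣ y
Admissible ((x , y) ∷ (x′ , y′) ∷ ps) = x ≥ 3 ℕ.+ y × x′ ≤ y × 2 ∣ (y ∸ x′) × Admissible ((x′ , y′) ∷ ps)

admissible-head : ∀ x y ps → Admissible ((x , y) ∷ ps) → x ≥ 3 ℕ.+ y
admissible-head x y []      (x≥3+y , _) = x≥3+y
admissible-head x y (_ ∷ _) (x≥3+y , _) = x≥3+y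

≥3+⇒≥ : ∀ {x y} → x ≥ 3 ℕ.+ y → y ≤ x
≥3+⇒≥ {x} {y} x≥3+y = ℕ.≤-trans (ℕ.m≤n+m y 3) x≥3+y

≥3+⇒≥1 : ∀ {x y} → x ≥ 3 ℕ.+ y → x ≥ 1
≥3+⇒≥1 x≥3+y = ℕ.≤-trans (s≤s z≤n) x≥3+y

admissible⇒InG' : ∀ ps → Admissible ps → InG' (flatten ps)
admissible⇒InG' ps adm = (positive ps adm , decreasing ps adm) , gaps ps adm
  where
  positive : ∀ ps → Admissible ps → All (_≥ 1) (flatten ps)
  positive []                          _                    = []
  positive ((x , zero)  ∷ [])          (x≥3 , _)            = ≥3+⇒≥1 x≥3 ∷ []
  positive ((x , suc y) ∷ [])          (x≥3+y , _)          = ≥3+⇒≥1 x≥3+y ∷ s≤s z≤n ∷ []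
  positive ((x , y) ∷ (x′ , y′) ∷ ps) (x≥3+y , x′≤y , _ , adm) =
    ≥3+⇒≥1 x≥3+y ∷ ℕ.≤-trans (≥3+⇒≥1 (admissible-head x′ y′ ps adm)) x′≤y ∷
    positive ((x′ , y′) ∷ ps) adm

  decreasing : ∀ ps → Admissible ps → Linked _≥_ (flatten ps)
  decreasing []                          _                       = []
  decreasing ((x , zero)  ∷ [])          _                       = [-]
  decreasing ((x , suc y) ∷ [])          (x≥3+y , _)             = ≥3+⇒≥ x≥3+y ∷ [-]
  decreasing ((x , y) ∷ (x′ , y′) ∷ ps) (x≥3+y , x′≤y , _ , adm) =
    ≥3+⇒≥ x≥3+y ∷ x′≤y ∷ decreasing ((x′ , y′) ∷ ps) adm

  gaps : ∀ ps → Admissible ps → GCond (flatten ps)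
  gaps []                          _                           = tt
  gaps ((x , zero)  ∷ [])          (x≥3 , _)                   = x≥3
  gaps ((x , suc y) ∷ [])          adm                         = adm
  gaps ((x , y) ∷ (x′ , y′) ∷ ps) (x≥3+y , _ , 2∣y-x′ , adm) = x≥3+y , 2∣y-x′ , gaps ((x′ , y′) ∷ ps) adm

InG'⇒admissible : ∀ ps → InG' ps → Admissible (pairUp ps)
InG'⇒admissible []                    _ = tt
InG'⇒admissible (x ∷ [])              (_ , x≥3)        = x≥3 , divides 0 refl
InG'⇒admissible (x ∷ y ∷ [])          (_ , cond)       = cond
InG'⇒admissible (x ∷ y ∷ z ∷ [])      ((_ ∷ _ ∷ _ , _ ∷ y≥z ∷ _) , x≥3+y , 2∣y-z , z≥3) =
  x≥3+y , y≥z , 2∣y-z , z≥3 , divides 0 refl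
InG'⇒admissible (x ∷ y ∷ z ∷ w ∷ ps) ((_ ∷ _ ∷ ps≥1 , _ ∷ y≥z ∷ ps↓) , x≥3+y , 2∣y-z , cond) =
  x≥3+y , y≥z , 2∣y-z , InG'⇒admissible (z ∷ w ∷ ps) ((ps≥1 , ps↓) , cond)

lead≥ : ∀ d e → lead d e ≥ 3 ℕ.+ 2 ℕ.* e
lead≥ d e = subst (3 ℕ.+ 2 ℕ.* e ≤_) (reorder d e) (ℕ.m≤n+m (3 ℕ.+ 2 ℕ.* e) d)
  where
  reorder : ∀ d e → d ℕ.+ (3 ℕ.+ 2 ℕ.* e) ≡ 3 ℕ.+ d ℕ.+ 2 ℕ.* e
  reorder = solve-∀

raise-≥3+ : ∀ {x y} c → x ≥ 3 ℕ.+ y → x ℕ.+ c ≥ 3 ℕ.+ (y ℕ.+ c)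
raise-≥3+ {x} {y} c x≥3+y = subst (_≤ x ℕ.+ c) (ℕ.+-assoc 3 y c) (ℕ.+-monoˡ-≤ c x≥3+y)

[m+o]∸[n+o]≡m∸n : ∀ m n o → (m ℕ.+ o) ∸ (n ℕ.+ o) ≡ m ∸ n
[m+o]∸[n+o]≡m∸n m n o = ≡.trans (cong₂ _∸_ (ℕ.+-comm m o) (ℕ.+-comm n o)) (ℕ.[m+n]∸[m+o]≡n∸o o m n)

admissible-raise-∷ʳ : ∀ ps c e → c ≥ 3 ℕ.+ 2 ℕ.* e → Admissible ps →
                      Admissible (map (raise c) ps ∷ʳ (c , 2 ℕ.* e))
admissible-raise-∷ʳ []                          c e c≥ _ = c≥ , divides e (ℕ.*-comm 2 e)
admissible-raise-∷ʳ ((x , y) ∷ [])              c e c≥ (x≥3+y , 2∣y) =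
  raise-≥3+ c x≥3+y , ℕ.m≤n+m c y , subst (2 ∣_) (≡.sym (ℕ.m+n∸n≡m y c)) 2∣y ,
  c≥ , divides e (ℕ.*-comm 2 e)
admissible-raise-∷ʳ ((x , y) ∷ (x′ , y′) ∷ ps) c e c≥ (x≥3+y , x′≤y , 2∣y-x′ , adm) =
  raise-≥3+ c x≥3+y , ℕ.+-monoˡ-≤ c x′≤y , subst (2 ∣_) (≡.sym ([m+o]∸[n+o]≡m∸n y x′ c)) 2∣y-x′ ,
  admissible-raise-∷ʳ ((x′ , y′) ∷ ps) c e c≥ adm

admissible-pairsOfGaps : ∀ n q → Admissible (pairsOfGaps n q)
admissible-pairsOfGaps zero    _             = tt
admissible-pairsOfGaps (suc n) ((q , d) , e) =
  admissible-raise-∷ʳ (pairsOfGaps n q) (lead d e) e (lead≥ d e) (admissible-pairsOfGaps n q)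

Below : ℕ → ℕ × ℕ → Set
Below u (x , y) = u ≤ x × u ≤ y

raise-lower : ∀ u ps → All (Below u) ps → map (raise u) (map (lower u) ps) ≡ ps
raise-lower u []             []                 = refl
raise-lower u ((x , y) ∷ ps) ((u≤x , u≤y) ∷ below) =
  cong₂ _∷_ (cong₂ _,_ (ℕ.m∸n+n≡m u≤x) (ℕ.m∸n+n≡m u≤y)) (raise-lower u ps below)

∸-∸-cancelʳ : ∀ u x y → u ≤ x → (y ∸ u) ∸ (x ∸ u) ≡ y ∸ x
∸-∸-cancelʳ zero    x       y       _         = refl
∸-∸-cancelʳ (suc u) (suc x) zero    (s≤s u≤x) = ℕ.0∸n≡0 (x ∸ u)
∸-∸-cancelʳ (suc u) (suc x) (suc y) (s≤s u≤x) = ∸-∸-cancelʳ u x y u≤x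

admissible-∷ʳ⁻ : ∀ ps u v → Admissible (ps ∷ʳ (u , v)) →
                 u ≥ 3 ℕ.+ v × 2 ∣ v × Admissible (map (lower u) ps) × All (Below u) ps
admissible-∷ʳ⁻ [] u v adm = proj₁ adm , proj₂ adm , tt , []
admissible-∷ʳ⁻ ((x , y) ∷ []) u v (x≥3+y , u≤y , 2∣y-u , u≥3+v , 2∣v) =
  u≥3+v , 2∣v ,
  (subst (_≤ x ∸ u) (ℕ.+-∸-assoc 3 u≤y) (ℕ.∸-monoˡ-≤ u x≥3+y) , 2∣y-u) ,
  (ℕ.≤-trans u≤y (≥3+⇒≥ x≥3+y) , u≤y) ∷ []
admissible-∷ʳ⁻ ((x , y) ∷ (x′ , y′) ∷ ps) u v (x≥3+y , x′≤y , 2∣y-x′ , adm)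
  with admissible-∷ʳ⁻ ((x′ , y′) ∷ ps) u v adm
... | u≥3+v , 2∣v , adm′ , below@((u≤x′ , _) ∷ _) =
  u≥3+v , 2∣v ,
  (subst (_≤ x ∸ u) (ℕ.+-∸-assoc 3 u≤y) (ℕ.∸-monoˡ-≤ u x≥3+y) ,
   ℕ.∸-monoˡ-≤ u x′≤y ,
   subst (2 ∣_) (≡.sym (∸-∸-cancelʳ u x′ y u≤x′)) 2∣y-x′ ,
   adm′) ,
  (ℕ.≤-trans u≤y (≥3+⇒≥ x≥3+y) , u≤y) ∷ below
  where
  u≤y : u ≤ y
  u≤y = ℕ.≤-trans u≤x′ x′≤y

lead-surjective : ∀ {u v} → u ≥ 3 ℕ.+ v → 2 ∣ v → Σ ℕ λ d → Σ ℕ λ e → lead d e ≡ u × 2 ℕ.* e ≡ v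
lead-surjective {u} {v} u≥3+v (divides e refl) =
  u ∸ (3 ℕ.+ 2 ℕ.* e) , e ,
  ≡.trans (reorder (u ∸ (3 ℕ.+ 2 ℕ.* e)) e)
          (ℕ.m∸n+n≡m (subst (λ v → 3 ℕ.+ v ≤ u) (ℕ.*-comm e 2) u≥3+v)) ,
  ℕ.*-comm 2 e
  where
  reorder : ∀ d e → 3 ℕ.+ d ℕ.+ 2 ℕ.* e ≡ d ℕ.+ (3 ℕ.+ 2 ℕ.* e)
  reorder = solve-∀

pairsOfGaps-surjective : ∀ n ps → Admissible ps → length ps ≡ n →
                         Σ (Obj (gapClass n)) λ q → pairsOfGaps n q ≡ ps
pairsOfGaps-surjective-∷ʳ : ∀ n xs u v → Admissible (xs ∷ʳ (u , v)) → length xs ≡ n →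
                            Σ (Obj (gapClass (suc n))) λ q → pairsOfGaps (suc n) q ≡ xs ∷ʳ (u , v)

pairsOfGaps-surjective zero    []  _   _       = tt , refl
pairsOfGaps-surjective (suc n) ps  adm length≡ with initLast ps
pairsOfGaps-surjective (suc n) .[] adm ()      | []
... | xs ∷ʳ′ (u , v) =
  pairsOfGaps-surjective-∷ʳ n xs u v adm (ℕ.suc-injective (≡.trans (≡.sym (length-∷ʳ xs _)) length≡))

pairsOfGaps-surjective-∷ʳ n xs u v adm length≡ with admissible-∷ʳ⁻ xs u v adm
... | u≥3+v , 2∣v , adm′ , below with lead-surjective u≥3+v 2∣v
...   | d , e , refl , refl
  with pairsOfGaps-surjective n (map (lower (lead d e)) xs) adm′ (≡.trans (length-map _ xs) length≡)
...     | q , q↦lowered = ((q , d) , e) , cong (_∷ʳ (lead d e , 2 ℕ.* e))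
                            (≡.trans (cong (map (raise (lead d e))) q↦lowered) (raise-lower (lead d e) xs below))

raise-injective : ∀ c {p p′} → raise c p ≡ raise c p′ → p ≡ p′
raise-injective c {x , y} {x′ , y′} eq =
  cong₂ _,_ (ℕ.+-cancelʳ-≡ c x x′ (cong proj₁ eq)) (ℕ.+-cancelʳ-≡ c y y′ (cong proj₂ eq))

lead-injective : ∀ {d d′ e e′} → lead d e ≡ lead d′ e′ → 2 ℕ.* e ≡ 2 ℕ.* e′ → d ≡ d′ × e ≡ e′
lead-injective {d} {d′} {e} lead≡ 2e≡ =
  ℕ.+-cancelˡ-≡ 3 d d′ (ℕ.+-cancelʳ-≡ (2 ℕ.* e) (3 ℕ.+ d) (3 ℕ.+ d′)
    (≡.trans lead≡ (cong (3 ℕ.+ d′ ℕ.+_) (≡.sym 2e≡)))) ,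
  ℕ.*-cancelˡ-≡ _ _ 2 2e≡

pairsOfGaps-injective : ∀ n {q q′} → pairsOfGaps n q ≡ pairsOfGaps n q′ → q ≡ q′
pairsOfGaps-injective zero    {tt}           {tt}              _  = refl
pairsOfGaps-injective (suc n) {(q , d) , e} {(q′ , d′) , e′} eq
  with ∷ʳ-injective (map (raise (lead d e)) (pairsOfGaps n q)) _ eq
... | raised≡ , last≡ with lead-injective {d} {d′} {e} {e′} (cong proj₁ last≡) (cong proj₂ last≡)
...   | refl , refl =
  cong (λ q → (q , d) , e) (pairsOfGaps-injective n (map-injective (raise-injective (lead d e)) raised≡))

termClass : ℕ → WeightedClass
termClass n = point (ex n) (ey n) ×ᶜ gapClass n

partitionOf : ∀ n → Obj (termClass n) → List ℕ
partitionOf n (_ , q) = flatten (pairsOfGaps n q)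

pairCount-partitionOf : ∀ n t → length (pairUp (partitionOf n t)) ≡ n
pairCount-partitionOf n (_ , q) =
  ≡.trans (cong length (pairUp-flatten (pairsOfGaps n q))) (length-pairsOfGaps n q)

partitionOf-injective : ∀ n {s t} → partitionOf n s ≡ partitionOf n t → s ≡ t
partitionOf-injective n {tt , q} {tt , q′} eq = cong (tt ,_) (pairsOfGaps-injective n
  (≡.trans (≡.sym (pairUp-flatten _)) (≡.trans (cong pairUp eq) (pairUp-flatten _))))

termPartitions : ℕ → ℕ → ℕ → List (List ℕ)
termPartitions a b n = map (partitionOf n) (enum (termClass n) a b)

termPartitions-unique : ∀ a b n → Unique (termPartitions a b n)
termPartitions-unique a b n = Unique.map⁺ (partitionOf-injective n) (enum-unique (termClass n) a b)

termPartitions-disjoint : ∀ a b {n m ps} → ps ∈ termPartitions a b n → ps ∈ termPartitions a b m → n ≡ m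
termPartitions-disjoint a b {n} {m} ps∈n ps∈m with ∈-map⁻ (partitionOf n) ps∈n | ∈-map⁻ (partitionOf m) ps∈m
... | s , _ , refl | t , _ , ps≡ =
  ≡.trans (≡.sym (pairCount-partitionOf n s)) (≡.trans (cong (length ∘ pairUp) ps≡) (pairCount-partitionOf m t))

gf-termClass : (P : ℕ → Series) → (∀ n → (P n *S denom n) ≈S oneS) →
               ∀ n → gf (termClass n) ≈ (mono (ex n) (ey n) *S P n)
gf-termClass P P-inverse n = begin
  gf (termClass n)                           ≈⟨ gf-×ᶜ (point (ex n) (ey n)) (gapClass n) ⟩
  gf (point (ex n) (ey n)) *S gf (gapClass n) ≈⟨ *S≈⊛ (gf (point (ex n) (ey n))) (gf (gapClass n)) ⟩
  gf (point (ex n) (ey n)) ⊛ gf (gapClass n)  ≈⟨ *-cong (gf-point (ex n) (ey n)) (≈-sym (inverse-of-denom P P-inverse n)) ⟩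
  mono (ex n) (ey n) ⊛ P n                    ≈⟨ *S≈⊛ (mono (ex n) (ey n)) (P n) ⟨
  mono (ex n) (ey n) *S P n                   ∎
  where open ≈-Reasoning

length-termPartitions : (P : ℕ → Series) → (∀ n → (P n *S denom n) ≈S oneS) →
                        ∀ a b n → + length (termPartitions a b n) ≡ (mono (ex n) (ey n) *S P n) a b
length-termPartitions P P-inverse a b n =
  ≡.trans (cong +_ (length-map (partitionOf n) (enum (termClass n) a b))) (gf-termClass P P-inverse n a b)

∈-termPartitions⁻ : ∀ {a b n ps} → ps ∈ termPartitions a b n → InG' ps × oddSum ps ≡ a × evenSum ps ≡ b
∈-termPartitions⁻ {a} {b} {n} ps∈ with ∈-map⁻ (partitionOf n) ps∈
... | (tt , q) , t∈ , refl =
  admissible⇒InG' (pairsOfGaps n q) (admissible-pairsOfGaps n q) ,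
  ≡.trans (proj₁ sums) (≡.trans (fstSum-pairsOfGaps n q) (proj₁ weights)) ,
  ≡.trans (proj₂ sums) (≡.trans (sndSum-pairsOfGaps n q) (proj₂ weights))
  where
  weights : ex n ℕ.+ wx (gapClass n) q ≡ a × ey n ℕ.+ wy (gapClass n) q ≡ b
  weights = enum-sound (termClass n) {i = a} {j = b} t∈
  sums : oddSum (flatten (pairsOfGaps n q)) ≡ sumWith proj₁ (pairsOfGaps n q) ×
         evenSum (flatten (pairsOfGaps n q)) ≡ sumWith proj₂ (pairsOfGaps n q)
  sums = sums-flatten (pairsOfGaps n q)

∈-termPartitions⁺ : ∀ {a b ps} → InG' ps → oddSum ps ≡ a → evenSum ps ≡ b →
                    Σ ℕ λ n → n ≤ a × ps ∈ termPartitions a b n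
∈-termPartitions⁺ {a} {b} {ps} ps∈G' odd≡a even≡b =
  n , ℕ.≤-trans (n≤ex n) (subst (ex n ≤_) wx≡a (ℕ.m≤m+n (ex n) (wx (gapClass n) q))) ,
  subst (_∈ termPartitions a b n) q↦ps (∈-map⁺ (partitionOf n) t∈)
  where
  n : ℕ
  n = length (pairUp ps)
  gaps : Σ (Obj (gapClass n)) λ q → pairsOfGaps n q ≡ pairUp ps
  gaps = pairsOfGaps-surjective n (pairUp ps) (InG'⇒admissible ps ps∈G') refl
  q : Obj (gapClass n)
  q = proj₁ gaps
  q↦ps : flatten (pairsOfGaps n q) ≡ ps
  q↦ps = ≡.trans (cong flatten (proj₂ gaps)) (flatten-pairUp ps (proj₁ (proj₁ ps∈G')))
  sums : oddSum ps ≡ sumWith proj₁ (pairsOfGaps n q) × evenSum ps ≡ sumWith proj₂ (pairsOfGaps n q)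
  sums = subst (λ ps′ → oddSum ps′ ≡ sumWith proj₁ (pairsOfGaps n q) ×
                        evenSum ps′ ≡ sumWith proj₂ (pairsOfGaps n q))
               q↦ps (sums-flatten (pairsOfGaps n q))
  wx≡a : ex n ℕ.+ wx (gapClass n) q ≡ a
  wx≡a = ≡.trans (≡.sym (fstSum-pairsOfGaps n q)) (≡.trans (≡.sym (proj₁ sums)) odd≡a)
  wy≡b : ey n ℕ.+ wy (gapClass n) q ≡ b
  wy≡b = ≡.trans (≡.sym (sndSum-pairsOfGaps n q)) (≡.trans (≡.sym (proj₂ sums)) even≡b)
  t∈ : (tt , q) ∈ enum (termClass n) a b
  t∈ = subst₂ (λ i j → (tt , q) ∈ enum (termClass n) i j) wx≡a wy≡b (enum-complete (termClass n) (tt , q))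

theorem5p9 : (P : ℕ → Series) → (∀ n → (P n *S denom n) ≈S oneS) →
    ∀ a b → Σ (List (List ℕ)) (λ L →
      Unique L ×
      (∀ ps → (ps ∈ L) ⇔ (InG' ps × oddSum ps ≡ a × evenSum ps ≡ b)) ×
      (+ length L ≡ rhsCoeff P a b))
theorem5p9 P P-inverse a b = L , L-unique , L-members , L-count
  where
  L : List (List ℕ)
  L = concatUpTo a (termPartitions a b)

  L-unique : Unique L
  L-unique = concatUpTo-unique a (termPartitions a b) (termPartitions-unique a b) (termPartitions-disjoint a b)

  L-members : ∀ ps → (ps ∈ L) ⇔ (InG' ps × oddSum ps ≡ a × evenSum ps ≡ b)
  L-members ps = mk⇔
    (λ ps∈ → let n , _ , ps∈n = ∈-concatUpTo⁻ a (termPartitions a b) ps∈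
             in ∈-termPartitions⁻ {a} {b} {n} ps∈n)
    (λ (ps∈G' , odd≡a , even≡b) → let n , n≤a , ps∈n = ∈-termPartitions⁺ ps∈G' odd≡a even≡b
                                  in ∈-concatUpTo⁺ a (termPartitions a b) n≤a ps∈n)

  L-count : + length L ≡ rhsCoeff P a b
  L-count = ≡.trans (length-concatUpTo a (termPartitions a b))
                    (sumUpTo-cong a (length-termPartitions P P-inverse a b))
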